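{- Let $K$ be a field of characteristic $0$, let $\sigma$ be a field automorphism of $K$, and let $r,s\in K$ with $r\neq0$. Let $\Lambda=(\lambda_1,\ldots,\lambda_m)$ be a sequence of elements of $K$ and let $\tilde\Lambda=(\tilde\lambda_1,\ldots,\tilde\lambda_m)$ with $\tilde\lambda_i=r\sigma(\lambda_i)+s$ for all $i$. Let $M=(\mu_{i,j})$ be an $m\times(n+1)$ multiplicity matrix. There is a polynomial $f(x)\in K[x]$ such that $M=M_f(\Lambda)$ if and only if there is a polynomial $\tilde f(x)\in K[x]$ such that $M=M_{\tilde f}(\tilde\Lambda)$.
   Context: For a polynomial $f$ of degree $n$ and a sequence $\Lambda=(\lambda_1,\ldots,\lambda_m)$ of elements of $K$, the multiplicity matrix $M_f(\Lambda)$ is the $m\times(n+1)$ matrix (rows $i\in\{1,\ldots,m\}$, columns $j\in\{0,\ldots,n\}$) whose $(i,j)$ entry is the multiplicity of $\lambda_i$ as a zero of $f^{(j)}(x)$ (which is $0$ if $f^{(j)}(\lambda_i)\neq0$). An $m\times(n+1)$ multiplicity matrix is a matrix $(\mu_{i,j})$ of nonnegative integers (columns $j=0,\ldots,n$) such that each row satisfies $\mu_{i,n}=0$ and $\mu_{i,j}\ge1\Rightarrow\mu_{i,j+1}=\mu_{i,j}-1$, and $\sum_{i=1}^m\mu_{i,j}\le n-j$ for all $j$. -}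

module Defs where

open import Level using (Level; _⊔_)
open import Algebra.Bundles using (CommutativeRing)
open import Algebra.Morphism.Structures using (IsRingIsomorphism)
open import Data.Nat using (ℕ; zero; suc; _≤_; _∸_)
open import Data.Fin using (Fin; toℕ; fromℕ; inject₁)
open import Data.List using (List; []; _∷_; tabulate)
open import Data.Nat.ListAction using (sum)
open import Data.Product using (Σ; ∃; _×_)
open import Relation.Binary.PropositionalEquality using (_≡_)
open import Relation.Nullary using (¬_)

record IsMultiplicityMatrix (m n : ℕ) (M : Fin m → Fin (suc n) → ℕ) : Set where
  field
    last-zero : ∀ i → M i (fromℕ n) ≡ 0
    step      : ∀ i (j : Fin n) → 1 ≤ M i (inject₁ j) →
                M i (Fin.suc j) ≡ M i (inject₁ j) ∸ 1
    col-sum   : ∀ (j : Fin (suc n)) →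
                sum (tabulate {n = m} (λ i → M i j)) ≤ n ∸ toℕ j

module _ {c ℓ : Level} (R : CommutativeRing c ℓ) where
  open CommutativeRing R

  record IsField : Set (c ⊔ ℓ) where
    field
      1≉0     : ¬ (1# ≈ 0#)
      inverse : ∀ x → ¬ (x ≈ 0#) → ∃ λ y → x * y ≈ 1#

  natR : ℕ → Carrier
  natR zero    = 0#
  natR (suc k) = 1# + natR k

  CharZero : Set ℓ
  CharZero = ∀ k → ¬ (natR (suc k) ≈ 0#)

  IsAutomorphism : (Carrier → Carrier) → Set (c ⊔ ℓ)
  IsAutomorphism σ = IsRingIsomorphism rawRing rawRing σ

  -- Polynomials as coefficient lists (constant term first).
  Poly : Set c
  Poly = List Carrier

  coeff : Poly → ℕ → Carrier
  coeff []       _       = 0#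
  coeff (a ∷ p)  zero    = a
  coeff (a ∷ p)  (suc k) = coeff p k

  -- Equality of polynomials: all coefficients agree (trailing zeros ignored).
  _≋_ : Poly → Poly → Set ℓ
  p ≋ q = ∀ k → coeff p k ≈ coeff q k

  _+ₚ_ : Poly → Poly → Poly
  []      +ₚ q       = q
  (a ∷ p) +ₚ []      = a ∷ p
  (a ∷ p) +ₚ (b ∷ q) = (a + b) ∷ (p +ₚ q)

  scale : Carrier → Poly → Poly
  scale a []      = []
  scale a (b ∷ q) = (a * b) ∷ scale a q

  _*ₚ_ : Poly → Poly → Poly
  []      *ₚ q = []
  (a ∷ p) *ₚ q = scale a q +ₚ (0# ∷ (p *ₚ q))

  _^ₚ_ : Poly → ℕ → Poly
  p ^ₚ zero  = 1# ∷ []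
  p ^ₚ suc k = p *ₚ (p ^ₚ k)

  _∣ₚ_ : Poly → Poly → Set (c ⊔ ℓ)
  p ∣ₚ g = ∃ λ q → g ≋ (p *ₚ q)

  X- : Carrier → Poly
  X- a = (- a) ∷ 1# ∷ []

  private
    derivFrom : ℕ → Poly → Poly
    derivFrom k []      = []
    derivFrom k (b ∷ p) = (natR k * b) ∷ derivFrom (suc k) p

  deriv : Poly → Poly
  deriv []      = []
  deriv (a ∷ p) = derivFrom 1 p

  deriv^ : ℕ → Poly → Poly
  deriv^ zero    f = f
  deriv^ (suc j) f = deriv (deriv^ j f)

  HasDegree : Poly → ℕ → Set ℓ
  HasDegree f n = ¬ (coeff f n ≈ 0#) × (∀ k → suc n ≤ k → coeff f k ≈ 0#)

  IsMultiplicity : Poly → Carrier → ℕ → Set (c ⊔ ℓ)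
  IsMultiplicity g a k = (X- a ^ₚ k) ∣ₚ g × ¬ ((X- a ^ₚ suc k) ∣ₚ g)

  IsMultMatrixOf : ∀ {m n} → Poly → (Fin m → Carrier) → (Fin m → Fin (suc n) → ℕ) → Set (c ⊔ ℓ)
  IsMultMatrixOf f Λ M = ∀ i j → IsMultiplicity (deriv^ (toℕ j) f) (Λ i) (M i j)

  Realizable : ∀ m n → (Fin m → Carrier) → (Fin m → Fin (suc n) → ℕ) → Set (c ⊔ ℓ)
  Realizable m n Λ M = Σ Poly λ f → HasDegree f n × IsMultMatrixOf f Λ M

{-# OPTIONS --safe #-}

-- Let T be a ring automorphism of K[x], with inverse U, that does not raise degrees and commutes
-- with differentiation up to a unit factor, and suppose T (x - λ) is a unit multiple of x - λ′ and
-- U (x - λ′) one of x - λ. Then (x - λ)^k ∣ f^(j) gives (x - λ′)^k ∣ T (f^(j)) ∼ (T f)^(j), while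
-- (x - λ′)^(k+1) ∣ (T f)^(j) pulls back along U to (x - λ)^(k+1) ∣ f^(j). So T f has the same
-- degree as f and the same multiplicity matrix at Λ′ as f has at Λ, and U transports back.
-- Applying σ to the coefficients is such an automorphism, moving the roots λ to σ(λ); so is the
-- substitution f(x) ↦ f(r x + s), moving r σ(λ) + s to σ(λ).

module Submission where

open import Defs
open import Algebra.Bundles using (CommutativeRing)
open import Data.Nat using (ℕ; suc)
open import Data.Fin using (Fin)
open import Function.Bundles using (_⇔_)
open import Relation.Nullary using (¬_)

open import Level using (_⊔_)
open import Algebra.Bundles using (CommutativeMonoid)
open import Algebra.Morphism.Structures using (module RingMorphisms)
import Algebra.Properties.CommutativeSemigroup as CommutativeSemigroupProperties
import Algebra.Properties.Ring as RingProperties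
open import Data.Nat using (zero; _≤_; z≤n; s≤s) renaming (_+_ to _+ℕ_)
import Data.Nat.Properties as ℕ
open import Data.Fin using (toℕ)
open import Data.List using ([]; _∷_; map)
open import Data.Product using (_,_; proj₁; proj₂)
open import Data.Sum using (inj₁; inj₂)
open import Function.Bundles using (mk⇔)
open import Function.Construct.Composition using (_⇔-∘_)
open import Function.Construct.Symmetry using (⇔-sym)
import Relation.Binary.PropositionalEquality as ≡
import Relation.Binary.Reasoning.Setoid as SetoidReasoning
open import Relation.Binary.Bundles using (Setoid)

module Polynomials {c ℓ} (R : CommutativeRing c ℓ) where

  open CommutativeRing R hiding (zero)
  open RingProperties ring using (-‿distribʳ-*; -‿+-comm)
  open CommutativeSemigroupProperties *-commutativeSemigroup
    using () renaming (interchange to *-interchange; x∙yz≈y∙xz to *-x∙yz≈y∙xz)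
  open RingMorphisms rawRing rawRing using (IsRingHomomorphism; IsRingIsomorphism)

  Pol : Set c
  Pol = Poly R

  coef : Pol → ℕ → Carrier
  coef = coeff R

  const : Carrier → Pol
  const a = a ∷ []

  infixl 6 _⊕_
  infixl 7 _⊛_
  infixr 8 _•_
  infixr 9 _⊛^_

  _⊕_ : Pol → Pol → Pol
  _⊕_ = _+ₚ_ R

  _•_ : Carrier → Pol → Pol
  _•_ = scale R

  _⊛_ : Pol → Pol → Pol
  _⊛_ = _*ₚ_ R

  _⊛^_ : Pol → ℕ → Pol
  _⊛^_ = _^ₚ_ R

  ∂ : Pol → Pol
  ∂ = deriv R

  -- Here and for divisibility, degree bounds and multiplicities we use records instead of the
  -- Σ- and Π-types of Defs, so that the polynomials involved can be inferred by unification.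
  infix 4 _≃_
  record _≃_ (p q : Pol) : Set ℓ where
    constructor mk≃
    field coeff≈ : _≋_ R p q
  open _≃_ public

  ≃-refl : ∀ {p} → p ≃ p
  ≃-refl = mk≃ λ _ → refl

  ≃-sym : ∀ {p q} → p ≃ q → q ≃ p
  ≃-sym p≃q = mk≃ λ k → sym (coeff≈ p≃q k)

  ≃-trans : ∀ {p q r} → p ≃ q → q ≃ r → p ≃ r
  ≃-trans p≃q q≃r = mk≃ λ k → trans (coeff≈ p≃q k) (coeff≈ q≃r k)

  ≃-setoid : Setoid c ℓ
  ≃-setoid = record
    { Carrier = Pol
    ; _≈_ = _≃_
    ; isEquivalence = record { refl = ≃-refl ; sym = ≃-sym ; trans = ≃-trans }
    }

  module ≃-Reasoning = SetoidReasoning ≃-setoid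
  module ≈-Reasoning = SetoidReasoning setoid

  ∷-cong : ∀ {a b p q} → a ≈ b → p ≃ q → a ∷ p ≃ b ∷ q
  ∷-cong a≈b p≃q = mk≃ λ { zero → a≈b ; (suc k) → coeff≈ p≃q k }

  ∷-injectiveˡ : ∀ {a b p q} → a ∷ p ≃ b ∷ q → a ≈ b
  ∷-injectiveˡ h = coeff≈ h 0

  ∷-injectiveʳ : ∀ {a b p q} → a ∷ p ≃ b ∷ q → p ≃ q
  ∷-injectiveʳ h = mk≃ λ k → coeff≈ h (suc k)

  ∷≃[]-head : ∀ {a p} → a ∷ p ≃ [] → a ≈ 0#
  ∷≃[]-head h = coeff≈ h 0

  ∷≃[]-tail : ∀ {a p} → a ∷ p ≃ [] → p ≃ []
  ∷≃[]-tail h = mk≃ λ k → coeff≈ h (suc k)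

  const≃[] : ∀ {a} → a ≈ 0# → const a ≃ []
  const≃[] a≈0 = mk≃ λ { zero → a≈0 ; (suc k) → refl }

  coef-⊕ : ∀ p q k → coef (p ⊕ q) k ≈ coef p k + coef q k
  coef-⊕ []      q       k       = sym (+-identityˡ _)
  coef-⊕ (a ∷ p) []      k       = sym (+-identityʳ _)
  coef-⊕ (a ∷ p) (b ∷ q) zero    = refl
  coef-⊕ (a ∷ p) (b ∷ q) (suc k) = coef-⊕ p q k

  ⊕-cong : ∀ {p p′ q q′} → p ≃ p′ → q ≃ q′ → p ⊕ q ≃ p′ ⊕ q′
  ⊕-cong {p} {p′} {q} {q′} p≃p′ q≃q′ = mk≃ λ k → begin
    coef (p ⊕ q) k          ≈⟨ coef-⊕ p q k ⟩
    coef p k + coef q k     ≈⟨ +-cong (coeff≈ p≃p′ k) (coeff≈ q≃q′ k) ⟩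
    coef p′ k + coef q′ k   ≈⟨ coef-⊕ p′ q′ k ⟨
    coef (p′ ⊕ q′) k        ∎
    where
    open ≈-Reasoning

  ⊕-congˡ : ∀ p {q q′} → q ≃ q′ → p ⊕ q ≃ p ⊕ q′
  ⊕-congˡ p = ⊕-cong ≃-refl

  ⊕-congʳ : ∀ {p p′} q → p ≃ p′ → p ⊕ q ≃ p′ ⊕ q
  ⊕-congʳ q p≃p′ = ⊕-cong p≃p′ ≃-refl

  ⊕-assoc : ∀ p q r → (p ⊕ q) ⊕ r ≃ p ⊕ (q ⊕ r)
  ⊕-assoc p q r = mk≃ λ k → begin
    coef ((p ⊕ q) ⊕ r) k              ≈⟨ trans (coef-⊕ (p ⊕ q) r k) (+-congʳ (coef-⊕ p q k)) ⟩
    (coef p k + coef q k) + coef r k  ≈⟨ +-assoc _ _ _ ⟩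
    coef p k + (coef q k + coef r k)  ≈⟨ trans (coef-⊕ p (q ⊕ r) k) (+-congˡ (coef-⊕ q r k)) ⟨
    coef (p ⊕ (q ⊕ r)) k              ∎
    where
    open ≈-Reasoning

  ⊕-comm : ∀ p q → p ⊕ q ≃ q ⊕ p
  ⊕-comm p q = mk≃ λ k → trans (coef-⊕ p q k) (trans (+-comm _ _) (sym (coef-⊕ q p k)))

  ⊕-identityʳ : ∀ p → p ⊕ [] ≃ p
  ⊕-identityʳ []      = ≃-refl
  ⊕-identityʳ (a ∷ p) = ≃-refl

  ⊕-commutativeMonoid : CommutativeMonoid c ℓ
  ⊕-commutativeMonoid = record
    { Carrier = Pol
    ; _≈_ = _≃_
    ; _∙_ = _⊕_
    ; ε = []
    ; isCommutativeMonoid = record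
      { isMonoid = record
        { isSemigroup = record
          { isMagma = record
            { isEquivalence = Setoid.isEquivalence ≃-setoid
            ; ∙-cong = ⊕-cong
            }
          ; assoc = ⊕-assoc
          }
        ; identity = (λ _ → ≃-refl) , ⊕-identityʳ
        }
      ; comm = ⊕-comm
      }
    }

  open CommutativeSemigroupProperties (CommutativeMonoid.commutativeSemigroup ⊕-commutativeMonoid)
    using () renaming (interchange to ⊕-interchange; x∙yz≈y∙xz to ⊕-x∙yz≈y∙xz)

  0∷⊕0∷ : ∀ p q → (0# ∷ p) ⊕ (0# ∷ q) ≃ 0# ∷ p ⊕ q
  0∷⊕0∷ p q = ∷-cong (+-identityˡ 0#) ≃-refl

  coef-• : ∀ a p k → coef (a • p) k ≈ a * coef p k
  coef-• a []      k       = sym (zeroʳ a)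
  coef-• a (b ∷ p) zero    = refl
  coef-• a (b ∷ p) (suc k) = coef-• a p k

  •-cong : ∀ {a b p q} → a ≈ b → p ≃ q → a • p ≃ b • q
  •-cong {a} {b} {p} {q} a≈b p≃q = mk≃ λ k →
    trans (coef-• a p k) (trans (*-cong a≈b (coeff≈ p≃q k)) (sym (coef-• b q k)))

  •-congˡ : ∀ a {p q} → p ≃ q → a • p ≃ a • q
  •-congˡ a = •-cong refl

  •-distrib-⊕ : ∀ a p q → a • (p ⊕ q) ≃ a • p ⊕ a • q
  •-distrib-⊕ a p q = mk≃ λ k → begin
    coef (a • (p ⊕ q)) k               ≈⟨ trans (coef-• a (p ⊕ q) k) (*-congˡ (coef-⊕ p q k)) ⟩
    a * (coef p k + coef q k)          ≈⟨ distribˡ a _ _ ⟩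
    a * coef p k + a * coef q k        ≈⟨ trans (coef-⊕ (a • p) (a • q) k) (+-cong (coef-• a p k) (coef-• a q k)) ⟨
    coef (a • p ⊕ a • q) k             ∎
    where
    open ≈-Reasoning

  •-distrib-+ : ∀ a b p → (a + b) • p ≃ a • p ⊕ b • p
  •-distrib-+ a b p = mk≃ λ k → begin
    coef ((a + b) • p) k               ≈⟨ coef-• (a + b) p k ⟩
    (a + b) * coef p k                 ≈⟨ distribʳ _ a b ⟩
    a * coef p k + b * coef p k        ≈⟨ trans (coef-⊕ (a • p) (b • p) k) (+-cong (coef-• a p k) (coef-• b p k)) ⟨
    coef (a • p ⊕ b • p) k             ∎
    where
    open ≈-Reasoning

  •-assoc : ∀ a b p → a • b • p ≃ (a * b) • p
  •-assoc a b p = mk≃ λ k → begin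
    coef (a • b • p) k   ≈⟨ trans (coef-• a (b • p) k) (*-congˡ (coef-• b p k)) ⟩
    a * (b * coef p k)   ≈⟨ *-assoc a b _ ⟨
    (a * b) * coef p k   ≈⟨ coef-• (a * b) p k ⟨
    coef ((a * b) • p) k ∎
    where
    open ≈-Reasoning

  •-comm : ∀ a b p → a • b • p ≃ b • a • p
  •-comm a b p = ≃-trans (•-assoc a b p) (≃-trans (•-cong (*-comm a b) ≃-refl) (≃-sym (•-assoc b a p)))

  •-identityˡ : ∀ p → 1# • p ≃ p
  •-identityˡ p = mk≃ λ k → trans (coef-• 1# p k) (*-identityˡ _)

  •-zeroˡ : ∀ p → 0# • p ≃ []
  •-zeroˡ p = mk≃ λ k → trans (coef-• 0# p k) (zeroˡ _)

  0∷-⊛ : ∀ p q → (0# ∷ p) ⊛ q ≃ 0# ∷ p ⊛ q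
  0∷-⊛ p q = ⊕-congʳ (0# ∷ p ⊛ q) (•-zeroˡ q)

  ⊛-zeroʳ : ∀ p → p ⊛ [] ≃ []
  ⊛-zeroʳ []      = ≃-refl
  ⊛-zeroʳ (a ∷ p) = ≃-trans (∷-cong refl (⊛-zeroʳ p)) (const≃[] refl)

  ⊛-zeroˡ : ∀ {p} q → p ≃ [] → p ⊛ q ≃ []
  ⊛-zeroˡ {[]}    q p≃[] = ≃-refl
  ⊛-zeroˡ {a ∷ p} q p≃[] = begin
    a • q ⊕ (0# ∷ p ⊛ q)
      ≈⟨ ⊕-cong (•-cong (∷≃[]-head p≃[]) ≃-refl) (∷-cong refl (⊛-zeroˡ q (∷≃[]-tail p≃[]))) ⟩
    0# • q ⊕ const 0#     ≈⟨ ⊕-cong (•-zeroˡ q) (const≃[] refl) ⟩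
    []                    ∎
    where
    open ≃-Reasoning

  ⊛-congˡ : ∀ {p p′} q → p ≃ p′ → p ⊛ q ≃ p′ ⊛ q
  ⊛-congˡ {[]}    {[]}     q h = ≃-refl
  ⊛-congˡ {[]}    {b ∷ p′} q h = ≃-sym (⊛-zeroˡ q (≃-sym h))
  ⊛-congˡ {a ∷ p} {[]}     q h = ⊛-zeroˡ q h
  ⊛-congˡ {a ∷ p} {b ∷ p′} q h =
    ⊕-cong (•-cong (∷-injectiveˡ h) ≃-refl) (∷-cong refl (⊛-congˡ q (∷-injectiveʳ h)))

  ⊛-congʳ : ∀ p {q q′} → q ≃ q′ → p ⊛ q ≃ p ⊛ q′
  ⊛-congʳ []      h = ≃-refl
  ⊛-congʳ (a ∷ p) h = ⊕-cong (•-congˡ a h) (∷-cong refl (⊛-congʳ p h))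

  ⊛-cong : ∀ {p p′ q q′} → p ≃ p′ → q ≃ q′ → p ⊛ q ≃ p′ ⊛ q′
  ⊛-cong {p′ = p′} {q} p≃p′ q≃q′ = ≃-trans (⊛-congˡ q p≃p′) (⊛-congʳ p′ q≃q′)

  •-⊛ : ∀ a p q → a • p ⊛ q ≃ a • (p ⊛ q)
  •-⊛ a []      q = ≃-refl
  •-⊛ a (b ∷ p) q = begin
    (a * b) • q ⊕ (0# ∷ a • p ⊛ q)     ≈⟨ ⊕-cong (≃-sym (•-assoc a b q)) (∷-cong (sym (zeroʳ a)) (•-⊛ a p q)) ⟩
    a • b • q ⊕ a • (0# ∷ p ⊛ q)       ≈⟨ •-distrib-⊕ a (b • q) (0# ∷ p ⊛ q) ⟨
    a • (b • q ⊕ (0# ∷ p ⊛ q))         ∎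
    where
    open ≃-Reasoning

  ⊛-• : ∀ a p q → p ⊛ a • q ≃ a • (p ⊛ q)
  ⊛-• a []      q = ≃-refl
  ⊛-• a (b ∷ p) q = begin
    b • a • q ⊕ (0# ∷ p ⊛ a • q)       ≈⟨ ⊕-cong (•-comm b a q) (∷-cong (sym (zeroʳ a)) (⊛-• a p q)) ⟩
    a • b • q ⊕ a • (0# ∷ p ⊛ q)       ≈⟨ •-distrib-⊕ a (b • q) (0# ∷ p ⊛ q) ⟨
    a • (b • q ⊕ (0# ∷ p ⊛ q))         ∎
    where
    open ≃-Reasoning

  ⊛-distribʳ : ∀ p q r → (p ⊕ q) ⊛ r ≃ p ⊛ r ⊕ q ⊛ r
  ⊛-distribʳ []      q       r = ≃-refl
  ⊛-distribʳ (a ∷ p) []      r = ≃-sym (⊕-identityʳ _)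
  ⊛-distribʳ (a ∷ p) (b ∷ q) r = begin
    (a + b) • r ⊕ (0# ∷ (p ⊕ q) ⊛ r)                   ≈⟨ ⊕-cong (•-distrib-+ a b r) (∷-cong refl (⊛-distribʳ p q r)) ⟩
    (a • r ⊕ b • r) ⊕ (0# ∷ p ⊛ r ⊕ q ⊛ r)             ≈⟨ ⊕-congˡ (a • r ⊕ b • r) (0∷⊕0∷ (p ⊛ r) (q ⊛ r)) ⟨
    (a • r ⊕ b • r) ⊕ ((0# ∷ p ⊛ r) ⊕ (0# ∷ q ⊛ r))    ≈⟨ ⊕-interchange (a • r) (b • r) _ _ ⟩
    (a • r ⊕ (0# ∷ p ⊛ r)) ⊕ (b • r ⊕ (0# ∷ q ⊛ r))    ∎
    where
    open ≃-Reasoning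

  ⊛-distribˡ : ∀ p q r → p ⊛ (q ⊕ r) ≃ p ⊛ q ⊕ p ⊛ r
  ⊛-distribˡ []      q r = ≃-refl
  ⊛-distribˡ (a ∷ p) q r = begin
    a • (q ⊕ r) ⊕ (0# ∷ p ⊛ (q ⊕ r))                   ≈⟨ ⊕-cong (•-distrib-⊕ a q r) (∷-cong refl (⊛-distribˡ p q r)) ⟩
    (a • q ⊕ a • r) ⊕ (0# ∷ p ⊛ q ⊕ p ⊛ r)             ≈⟨ ⊕-congˡ (a • q ⊕ a • r) (0∷⊕0∷ (p ⊛ q) (p ⊛ r)) ⟨
    (a • q ⊕ a • r) ⊕ ((0# ∷ p ⊛ q) ⊕ (0# ∷ p ⊛ r))    ≈⟨ ⊕-interchange (a • q) (a • r) _ _ ⟩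
    (a • q ⊕ (0# ∷ p ⊛ q)) ⊕ (a • r ⊕ (0# ∷ p ⊛ r))    ∎
    where
    open ≃-Reasoning

  ⊛-assoc : ∀ p q r → (p ⊛ q) ⊛ r ≃ p ⊛ (q ⊛ r)
  ⊛-assoc []      q r = ≃-refl
  ⊛-assoc (a ∷ p) q r = begin
    (a • q ⊕ (0# ∷ p ⊛ q)) ⊛ r       ≈⟨ ⊛-distribʳ (a • q) (0# ∷ p ⊛ q) r ⟩
    a • q ⊛ r ⊕ (0# ∷ p ⊛ q) ⊛ r     ≈⟨ ⊕-cong (•-⊛ a q r) (0∷-⊛ (p ⊛ q) r) ⟩
    a • (q ⊛ r) ⊕ (0# ∷ p ⊛ q ⊛ r)   ≈⟨ ⊕-congˡ (a • (q ⊛ r)) (∷-cong refl (⊛-assoc p q r)) ⟩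
    a • (q ⊛ r) ⊕ (0# ∷ p ⊛ (q ⊛ r)) ∎
    where
    open ≃-Reasoning

  const-⊛ : ∀ a q → const a ⊛ q ≃ a • q
  const-⊛ a q = ≃-trans (⊕-congˡ (a • q) (const≃[] refl)) (⊕-identityʳ _)

  ⊛-const : ∀ a p → p ⊛ const a ≃ a • p
  ⊛-const a []      = ≃-refl
  ⊛-const a (b ∷ p) = ∷-cong (trans (+-identityʳ _) (*-comm b a)) (⊛-const a p)

  x-⊛ : ∀ p → (0# ∷ const 1#) ⊛ p ≃ 0# ∷ p
  x-⊛ p = ≃-trans (0∷-⊛ (const 1#) p) (∷-cong refl (≃-trans (const-⊛ 1# p) (•-identityˡ p)))

  ⊛-identityʳ : ∀ p → p ⊛ const 1# ≃ p
  ⊛-identityʳ p = ≃-trans (⊛-const 1# p) (•-identityˡ p)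

  ⊛^-cong : ∀ {p q} k → p ≃ q → p ⊛^ k ≃ q ⊛^ k
  ⊛^-cong zero    p≃q = ≃-refl
  ⊛^-cong (suc k) p≃q = ⊛-cong p≃q (⊛^-cong k p≃q)

  -- Divisibility, associates and multiplicities of roots

  infix 4 _∣_ _∼_

  record _∣_ (p g : Pol) : Set (c ⊔ ℓ) where
    constructor divides
    field
      quotient : Pol
      equation : g ≃ p ⊛ quotient

  ∣ₚ⇒∣ : ∀ {p g} → _∣ₚ_ R p g → p ∣ g
  ∣ₚ⇒∣ (q , g≋pq) = divides q (mk≃ g≋pq)

  ∣⇒∣ₚ : ∀ {p g} → p ∣ g → _∣ₚ_ R p g
  ∣⇒∣ₚ (divides q g≃pq) = q , coeff≈ g≃pq

  ∣-trans : ∀ {p q g} → p ∣ q → q ∣ g → p ∣ g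
  ∣-trans {p} (divides s q≃ps) (divides t g≃qt) =
    divides (s ⊛ t) (≃-trans g≃qt (≃-trans (⊛-congˡ t q≃ps) (⊛-assoc p s t)))

  ∣-respʳ : ∀ {p g h} → g ≃ h → p ∣ g → p ∣ h
  ∣-respʳ g≃h (divides q g≃pq) = divides q (≃-trans (≃-sym g≃h) g≃pq)

  record _∼_ (p q : Pol) : Set (c ⊔ ℓ) where
    field
      factor factor⁻¹ : Carrier
      factor-inverse  : factor * factor⁻¹ ≈ 1#
      scaled          : p ≃ factor • q

  ≃⇒∼ : ∀ {p q} → p ≃ q → p ∼ q
  ≃⇒∼ {q = q} p≃q = record
    { factor = 1# ; factor⁻¹ = 1# ; factor-inverse = *-identityˡ 1#
    ; scaled = ≃-trans p≃q (≃-sym (•-identityˡ q))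
    }

  ∼-sym : ∀ {p q} → p ∼ q → q ∼ p
  ∼-sym {p} {q} p∼q = record
    { factor = factor⁻¹ ; factor⁻¹ = factor
    ; factor-inverse = trans (*-comm factor⁻¹ factor) factor-inverse
    ; scaled = begin
        q                          ≈⟨ •-identityˡ q ⟨
        1# • q                     ≈⟨ •-cong (trans (*-comm factor⁻¹ factor) factor-inverse) ≃-refl ⟨
        (factor⁻¹ * factor) • q    ≈⟨ •-assoc factor⁻¹ factor q ⟨
        factor⁻¹ • factor • q      ≈⟨ •-congˡ factor⁻¹ scaled ⟨
        factor⁻¹ • p               ∎
    }
    where
    open _∼_ p∼q
    open ≃-Reasoning

  private
    inverse-* : ∀ {u u⁻¹ v v⁻¹} → u * u⁻¹ ≈ 1# → v * v⁻¹ ≈ 1# → (u * v) * (u⁻¹ * v⁻¹) ≈ 1#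
    inverse-* {u} {u⁻¹} {v} {v⁻¹} uu⁻¹≈1 vv⁻¹≈1 = begin
      (u * v) * (u⁻¹ * v⁻¹)   ≈⟨ *-interchange u v u⁻¹ v⁻¹ ⟩
      (u * u⁻¹) * (v * v⁻¹)   ≈⟨ *-cong uu⁻¹≈1 vv⁻¹≈1 ⟩
      1# * 1#                 ≈⟨ *-identityˡ 1# ⟩
      1#                      ∎
      where
      open ≈-Reasoning

  ∼-trans : ∀ {p q r} → p ∼ q → q ∼ r → p ∼ r
  ∼-trans {p} {q} {r} p∼q q∼r = record
    { factor = u * v ; factor⁻¹ = u⁻¹ * v⁻¹
    ; factor-inverse = inverse-* (_∼_.factor-inverse p∼q) (_∼_.factor-inverse q∼r)
    ; scaled = ≃-trans (_∼_.scaled p∼q) (≃-trans (•-congˡ u (_∼_.scaled q∼r)) (•-assoc u v r))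
    }
    where
    open _∼_ p∼q using () renaming (factor to u; factor⁻¹ to u⁻¹)
    open _∼_ q∼r using () renaming (factor to v; factor⁻¹ to v⁻¹)

  ∼-⊛ : ∀ {p q p′ q′} → p ∼ q → p′ ∼ q′ → p ⊛ p′ ∼ q ⊛ q′
  ∼-⊛ {p} {q} {p′} {q′} p∼q p′∼q′ = record
    { factor = u * v ; factor⁻¹ = u⁻¹ * v⁻¹
    ; factor-inverse = inverse-* (_∼_.factor-inverse p∼q) (_∼_.factor-inverse p′∼q′)
    ; scaled = begin
        p ⊛ p′               ≈⟨ ⊛-cong (_∼_.scaled p∼q) (_∼_.scaled p′∼q′) ⟩
        u • q ⊛ v • q′       ≈⟨ •-⊛ u q (v • q′) ⟩
        u • (q ⊛ v • q′)     ≈⟨ •-congˡ u (⊛-• v q q′) ⟩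
        u • v • (q ⊛ q′)     ≈⟨ •-assoc u v (q ⊛ q′) ⟩
        (u * v) • (q ⊛ q′)   ∎
    }
    where
    open _∼_ p∼q using () renaming (factor to u; factor⁻¹ to u⁻¹)
    open _∼_ p′∼q′ using () renaming (factor to v; factor⁻¹ to v⁻¹)
    open ≃-Reasoning

  ∼-⊛^ : ∀ {p q} k → p ∼ q → p ⊛^ k ∼ q ⊛^ k
  ∼-⊛^ zero    p∼q = ≃⇒∼ ≃-refl
  ∼-⊛^ (suc k) p∼q = ∼-⊛ p∼q (∼-⊛^ k p∼q)

  ∼⇒∣ : ∀ {p q} → p ∼ q → q ∣ p
  ∼⇒∣ {q = q} p∼q = divides (const factor) (≃-trans scaled (≃-sym (⊛-const factor q)))
    where
    open _∼_ p∼q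

  record Multiplicity (g : Pol) (a : Carrier) (k : ℕ) : Set (c ⊔ ℓ) where
    constructor _,_
    field
      factor-∣  : X- R a ⊛^ k ∣ g
      factor-∤  : ¬ X- R a ⊛^ suc k ∣ g

  fromIsMultiplicity : ∀ g {a k} → IsMultiplicity R g a k → Multiplicity g a k
  fromIsMultiplicity g (a^k∣g , ¬a^1+k∣g) = ∣ₚ⇒∣ a^k∣g , λ a^1+k∣g → ¬a^1+k∣g (∣⇒∣ₚ a^1+k∣g)

  toIsMultiplicity : ∀ {g a k} → Multiplicity g a k → IsMultiplicity R g a k
  toIsMultiplicity (a^k∣g , ¬a^1+k∣g) = ∣⇒∣ₚ a^k∣g , λ a^1+k∣g → ¬a^1+k∣g (∣ₚ⇒∣ a^1+k∣g)

  multiplicity-resp-∼ : ∀ {g h a k} → g ∼ h → Multiplicity g a k → Multiplicity h a k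
  multiplicity-resp-∼ g∼h (a^k∣g , ¬a^1+k∣g) =
    ∣-trans a^k∣g (∼⇒∣ (∼-sym g∼h)) , λ a^1+k∣h → ¬a^1+k∣g (∣-trans a^1+k∣h (∼⇒∣ g∼h))

  -- Formal derivative

  -- Defs keeps the helper of deriv private. This meta is solved to it by unification in
  -- ∂≡derivFrom, where abstracting the literal 1 turns the constraint into a pattern.
  mutual
    derivFrom : ℕ → Pol → Pol
    derivFrom = _

    ∂≡derivFrom : ∀ a p → ∂ (a ∷ p) ≡.≡ derivFrom 1 p
    ∂≡derivFrom a p with 1
    ... | k = ≡.refl

  coef-derivFrom : ∀ k p j → coef (derivFrom k p) j ≈ natR R (k +ℕ j) * coef p j
  coef-derivFrom k []      j       = sym (zeroʳ _)
  coef-derivFrom k (b ∷ p) zero    = reflexive (≡.cong (λ i → natR R i * b) (≡.sym (ℕ.+-identityʳ k)))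
  coef-derivFrom k (b ∷ p) (suc j) = trans (coef-derivFrom (suc k) p j)
    (reflexive (≡.cong (λ i → natR R i * coef p j) (≡.sym (ℕ.+-suc k j))))

  coef-∂ : ∀ p j → coef (∂ p) j ≈ natR R (suc j) * coef p (suc j)
  coef-∂ []      j = sym (zeroʳ _)
  coef-∂ (a ∷ p) j = trans (reflexive (≡.cong (λ q → coef q j) (∂≡derivFrom a p))) (coef-derivFrom 1 p j)

  ∂-cong : ∀ {p q} → p ≃ q → ∂ p ≃ ∂ q
  ∂-cong {p} {q} p≃q = mk≃ λ j →
    trans (coef-∂ p j) (trans (*-congˡ (coeff≈ p≃q (suc j))) (sym (coef-∂ q j)))

  ∂-⊕ : ∀ p q → ∂ (p ⊕ q) ≃ ∂ p ⊕ ∂ q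
  ∂-⊕ p q = mk≃ λ j → begin
    coef (∂ (p ⊕ q)) j                                ≈⟨ trans (coef-∂ (p ⊕ q) j) (*-congˡ (coef-⊕ p q (suc j))) ⟩
    natR R (suc j) * (coef p (suc j) + coef q (suc j)) ≈⟨ distribˡ _ _ _ ⟩
    natR R (suc j) * coef p (suc j) + natR R (suc j) * coef q (suc j)
      ≈⟨ trans (coef-⊕ (∂ p) (∂ q) j) (+-cong (coef-∂ p j) (coef-∂ q j)) ⟨
    coef (∂ p ⊕ ∂ q) j                                ∎
    where
    open ≈-Reasoning

  ∂-• : ∀ a p → ∂ (a • p) ≃ a • ∂ p
  ∂-• a p = mk≃ λ j → begin
    coef (∂ (a • p)) j                  ≈⟨ trans (coef-∂ (a • p) j) (*-congˡ (coef-• a p (suc j))) ⟩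
    natR R (suc j) * (a * coef p (suc j)) ≈⟨ *-x∙yz≈y∙xz _ _ _ ⟩
    a * (natR R (suc j) * coef p (suc j)) ≈⟨ trans (coef-• a (∂ p) j) (*-congˡ (coef-∂ p j)) ⟨
    coef (a • ∂ p) j                    ∎
    where
    open ≈-Reasoning

  ∂-∷ : ∀ a p → ∂ (a ∷ p) ≃ p ⊕ (0# ∷ ∂ p)
  ∂-∷ a p = mk≃ coefficients
    where
    open ≈-Reasoning
    coefficients : ∀ j → coef (∂ (a ∷ p)) j ≈ coef (p ⊕ (0# ∷ ∂ p)) j
    coefficients zero = begin
      coef (∂ (a ∷ p)) 0          ≈⟨ coef-∂ (a ∷ p) 0 ⟩
      (1# + 0#) * coef p 0        ≈⟨ trans (*-congʳ (+-identityʳ 1#)) (*-identityˡ _) ⟩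
      coef p 0                    ≈⟨ +-identityʳ _ ⟨
      coef p 0 + 0#               ≈⟨ coef-⊕ p (0# ∷ ∂ p) 0 ⟨
      coef (p ⊕ (0# ∷ ∂ p)) 0     ∎
    coefficients (suc j) = begin
      coef (∂ (a ∷ p)) (suc j)                                   ≈⟨ coef-∂ (a ∷ p) (suc j) ⟩
      (1# + natR R (suc j)) * coef p (suc j)                     ≈⟨ distribʳ _ 1# _ ⟩
      1# * coef p (suc j) + natR R (suc j) * coef p (suc j)      ≈⟨ +-cong (*-identityˡ _) (sym (coef-∂ p j)) ⟩
      coef p (suc j) + coef (∂ p) j                              ≈⟨ coef-⊕ p (0# ∷ ∂ p) (suc j) ⟨
      coef (p ⊕ (0# ∷ ∂ p)) (suc j)                              ∎

  ∂-leibniz : ∀ p q → ∂ (p ⊛ q) ≃ ∂ p ⊛ q ⊕ p ⊛ ∂ q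
  ∂-leibniz []      q = ≃-refl
  ∂-leibniz (a ∷ p) q = begin
    ∂ (a • q ⊕ (0# ∷ p ⊛ q))
      ≈⟨ ≃-trans (∂-⊕ (a • q) (0# ∷ p ⊛ q)) (⊕-cong (∂-• a q) (∂-∷ 0# (p ⊛ q))) ⟩
    a • ∂ q ⊕ (p ⊛ q ⊕ (0# ∷ ∂ (p ⊛ q)))
      ≈⟨ ⊕-congˡ (a • ∂ q) (⊕-congˡ (p ⊛ q) (∷-cong refl (∂-leibniz p q))) ⟩
    a • ∂ q ⊕ (p ⊛ q ⊕ (0# ∷ ∂ p ⊛ q ⊕ p ⊛ ∂ q))
      ≈⟨ ⊕-congˡ (a • ∂ q) (⊕-congˡ (p ⊛ q) (0∷⊕0∷ (∂ p ⊛ q) (p ⊛ ∂ q))) ⟨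
    a • ∂ q ⊕ (p ⊛ q ⊕ ((0# ∷ ∂ p ⊛ q) ⊕ (0# ∷ p ⊛ ∂ q)))
      ≈⟨ ⊕-congˡ (a • ∂ q) (⊕-assoc (p ⊛ q) (0# ∷ ∂ p ⊛ q) (0# ∷ p ⊛ ∂ q)) ⟨
    a • ∂ q ⊕ ((p ⊛ q ⊕ (0# ∷ ∂ p ⊛ q)) ⊕ (0# ∷ p ⊛ ∂ q))
      ≈⟨ ⊕-x∙yz≈y∙xz (a • ∂ q) (p ⊛ q ⊕ (0# ∷ ∂ p ⊛ q)) (0# ∷ p ⊛ ∂ q) ⟩
    (p ⊛ q ⊕ (0# ∷ ∂ p ⊛ q)) ⊕ (a • ∂ q ⊕ (0# ∷ p ⊛ ∂ q))
      ≈⟨ ⊕-congʳ _ (≃-trans (⊛-distribʳ p (0# ∷ ∂ p) q) (⊕-congˡ (p ⊛ q) (0∷-⊛ (∂ p) q))) ⟨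
    (p ⊕ (0# ∷ ∂ p)) ⊛ q ⊕ (a ∷ p) ⊛ ∂ q
      ≈⟨ ⊕-congʳ _ (⊛-congˡ q (∂-∷ a p)) ⟨
    ∂ (a ∷ p) ⊛ q ⊕ (a ∷ p) ⊛ ∂ q
      ∎
    where
    open ≃-Reasoning

  ∂-∼ : ∀ {p q} → p ∼ q → ∂ p ∼ ∂ q
  ∂-∼ {q = q} p∼q = record
    { factor = factor ; factor⁻¹ = factor⁻¹ ; factor-inverse = factor-inverse
    ; scaled = ≃-trans (∂-cong scaled) (∂-• factor q)
    }
    where
    open _∼_ p∼q

  record DegreeBelow (p : Pol) (n : ℕ) : Set ℓ where
    constructor degree<
    field vanishes : ∀ k → n ≤ k → coef p k ≈ 0#
  open DegreeBelow public

  degreeBelow-resp : ∀ {p q n} → p ≃ q → DegreeBelow p n → DegreeBelow q n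
  degreeBelow-resp p≃q (degree< p<n) = degree< λ k n≤k → trans (sym (coeff≈ p≃q k)) (p<n k n≤k)

  degreeBelow-suc : ∀ {p n} → DegreeBelow p n → DegreeBelow p (suc n)
  degreeBelow-suc (degree< p<n) = degree< λ k n<k → p<n k (ℕ.<⇒≤ n<k)

  degreeBelow-pred : ∀ {p n} → DegreeBelow p (suc n) → coef p n ≈ 0# → DegreeBelow p n
  degreeBelow-pred {p} {n} (degree< p<1+n) pₙ≈0 = degree< vanishes-from-n
    where
    vanishes-from-n : ∀ k → n ≤ k → coef p k ≈ 0#
    vanishes-from-n k n≤k with ℕ.m≤n⇒m<n∨m≡n n≤k
    ... | inj₁ n<k    = p<1+n k n<k
    ... | inj₂ ≡.refl = pₙ≈0

  degreeBelow-⊕ : ∀ {p q n} → DegreeBelow p n → DegreeBelow q n → DegreeBelow (p ⊕ q) n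
  degreeBelow-⊕ {p} {q} (degree< p<n) (degree< q<n) = degree< λ k n≤k →
    trans (coef-⊕ p q k) (trans (+-cong (p<n k n≤k) (q<n k n≤k)) (+-identityˡ 0#))

  degreeBelow-• : ∀ a {p n} → DegreeBelow p n → DegreeBelow (a • p) n
  degreeBelow-• a {p} (degree< p<n) = degree< λ k n≤k →
    trans (coef-• a p k) (trans (*-congˡ (p<n k n≤k)) (zeroʳ a))

  degreeBelow-∷ : ∀ a {p n} → DegreeBelow p n → DegreeBelow (a ∷ p) (suc n)
  degreeBelow-∷ a (degree< p<n) = degree< λ { (suc k) (s≤s n≤k) → p<n k n≤k }

  degreeBelow-tail : ∀ {a p n} → DegreeBelow (a ∷ p) (suc n) → DegreeBelow p n
  degreeBelow-tail (degree< ap<1+n) = degree< λ k n≤k → ap<1+n (suc k) (s≤s n≤k)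

  degreeBelow-[] : ∀ {n} → DegreeBelow [] n
  degreeBelow-[] = degree< λ _ _ → refl

  degreeBelow-const : ∀ a {n} → DegreeBelow (const a) (suc n)
  degreeBelow-const a = degreeBelow-∷ a degreeBelow-[]

  degreeBelow-zero : ∀ {p} → DegreeBelow p 0 → p ≃ []
  degreeBelow-zero (degree< p<0) = mk≃ λ k → p<0 k z≤n

  -- Automorphisms of K[x] preserving multiplicity matrices

  record IsAdmissible (T : Pol → Pol) : Set (c ⊔ ℓ) where
    field
      cong        : ∀ {p q} → p ≃ q → T p ≃ T q
      ⊛-homo      : ∀ p q → T (p ⊛ q) ≃ T p ⊛ T q
      1-homo      : T (const 1#) ≃ const 1#
      degreeBelow : ∀ {p n} → DegreeBelow p n → DegreeBelow (T p) n
      ∂-homo      : ∀ p → ∂ (T p) ∼ T (∂ p)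

    ⊛^-homo : ∀ p k → T (p ⊛^ k) ≃ T p ⊛^ k
    ⊛^-homo p zero    = 1-homo
    ⊛^-homo p (suc k) = ≃-trans (⊛-homo p (p ⊛^ k)) (⊛-congʳ (T p) (⊛^-homo p k))

    ∣-homo : ∀ {p g} → p ∣ g → T p ∣ T g
    ∣-homo {p} (divides q g≃pq) = divides (T q) (≃-trans (cong g≃pq) (⊛-homo p q))

    ⊛^-∣-image : ∀ {p q} k → T p ∼ q → q ⊛^ k ∣ T (p ⊛^ k)
    ⊛^-∣-image {p} k Tp∼q = ∣-respʳ (≃-sym (⊛^-homo p k)) (∼⇒∣ (∼-⊛^ k Tp∼q))

    ∂^-homo : ∀ j p → deriv^ R j (T p) ∼ T (deriv^ R j p)
    ∂^-homo zero    p = ≃⇒∼ ≃-refl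
    ∂^-homo (suc j) p = ∼-trans (∂-∼ (∂^-homo j p)) (∂-homo (deriv^ R j p))

  record PolyAutomorphism : Set (c ⊔ ℓ) where
    field
      to from         : Pol → Pol
      to-admissible   : IsAdmissible to
      from-admissible : IsAdmissible from
      from-to         : ∀ p → from (to p) ≃ p
      to-from         : ∀ p → to (from p) ≃ p

  _⁻¹ : PolyAutomorphism → PolyAutomorphism
  Φ ⁻¹ = record
    { to = from ; from = to
    ; to-admissible = from-admissible ; from-admissible = to-admissible
    ; from-to = to-from ; to-from = from-to
    }
    where
    open PolyAutomorphism Φ

  module _ (Φ : PolyAutomorphism) where
    open PolyAutomorphism Φ
    private
      module T = IsAdmissible to-admissible
      module U = IsAdmissible from-admissible

    hasDegree-image : ∀ {f n} → HasDegree R f n → HasDegree R (to f) n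
    hasDegree-image {f} {n} (fₙ≉0 , f<1+n) = Tfₙ≉0 , vanishes Tf<1+n
      where
      Tf<1+n : DegreeBelow (to f) (suc n)
      Tf<1+n = T.degreeBelow (degree< f<1+n)
      Tfₙ≉0 : ¬ coef (to f) n ≈ 0#
      Tfₙ≉0 Tfₙ≈0 =
        fₙ≉0 (vanishes (degreeBelow-resp (from-to f) (U.degreeBelow (degreeBelow-pred Tf<1+n Tfₙ≈0))) n ℕ.≤-refl)

    multiplicity-image : ∀ {g a b k} → to (X- R a) ∼ X- R b → from (X- R b) ∼ X- R a →
                         Multiplicity g a k → Multiplicity (to g) b k
    multiplicity-image {g} {k = k} Ta∼b Ub∼a (a^k∣g , ¬a^1+k∣g) =
        ∣-trans (T.⊛^-∣-image k Ta∼b) (T.∣-homo a^k∣g)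
      , λ b^1+k∣Tg → ¬a^1+k∣g
          (∣-respʳ (from-to g) (∣-trans (U.⊛^-∣-image (suc k) Ub∼a) (U.∣-homo b^1+k∣Tg)))

    realizable-image : ∀ {m n Λ Λ′ M} →
                       (∀ i → to (X- R (Λ i)) ∼ X- R (Λ′ i)) → (∀ i → from (X- R (Λ′ i)) ∼ X- R (Λ i)) →
                       Realizable R m n Λ M → Realizable R m n Λ′ M
    realizable-image {n = n} {Λ} {Λ′} {M} Tλ∼λ′ Uλ′∼λ (f , f-degree , f-multiplicities) =
      to f , hasDegree-image f-degree , Tf-multiplicities
      where
      Tf-multiplicities : IsMultMatrixOf R {n = n} (to f) Λ′ M
      Tf-multiplicities i j = toIsMultiplicity {a = Λ′ i} {M i j}
        (multiplicity-resp-∼ (∼-sym (T.∂^-homo (toℕ j) f))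
          (multiplicity-image (Tλ∼λ′ i) (Uλ′∼λ i)
            (fromIsMultiplicity (deriv^ R (toℕ j) f) {Λ i} {M i j} (f-multiplicities i j))))

  realizable-⇔ : ∀ (Φ : PolyAutomorphism) {m n Λ Λ′ M} → let open PolyAutomorphism Φ in
                 (∀ i → to (X- R (Λ i)) ∼ X- R (Λ′ i)) → (∀ i → from (X- R (Λ′ i)) ∼ X- R (Λ i)) →
                 Realizable R m n Λ M ⇔ Realizable R m n Λ′ M
  realizable-⇔ Φ {M = M} Tλ∼λ′ Uλ′∼λ =
    mk⇔ (realizable-image Φ {M = M} Tλ∼λ′ Uλ′∼λ) (realizable-image (Φ ⁻¹) {M = M} Uλ′∼λ Tλ∼λ′)

  X-cong : ∀ {a b} → a ≈ b → X- R a ≃ X- R b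
  X-cong a≈b = ∷-cong (-‿cong a≈b) ≃-refl

  map-inverse : ∀ {φ ψ : Carrier → Carrier} → (∀ x → ψ (φ x) ≈ x) → ∀ p → map ψ (map φ p) ≃ p
  map-inverse ψφ≈id []      = ≃-refl
  map-inverse ψφ≈id (a ∷ p) = ∷-cong (ψφ≈id a) (map-inverse ψφ≈id p)

  module _ {φ : Carrier → Carrier} (φ-hom : IsRingHomomorphism φ) where
    open IsRingHomomorphism φ-hom

    coef-map : ∀ p k → coef (map φ p) k ≈ φ (coef p k)
    coef-map []      k       = sym 0#-homo
    coef-map (a ∷ p) zero    = refl
    coef-map (a ∷ p) (suc k) = coef-map p k

    map-cong : ∀ {p q} → p ≃ q → map φ p ≃ map φ q
    map-cong {p} {q} p≃q = mk≃ λ k →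
      trans (coef-map p k) (trans (⟦⟧-cong (coeff≈ p≃q k)) (sym (coef-map q k)))

    map-⊕ : ∀ p q → map φ (p ⊕ q) ≃ map φ p ⊕ map φ q
    map-⊕ p q = mk≃ λ k → begin
      coef (map φ (p ⊕ q)) k              ≈⟨ trans (coef-map (p ⊕ q) k) (⟦⟧-cong (coef-⊕ p q k)) ⟩
      φ (coef p k + coef q k)             ≈⟨ +-homo _ _ ⟩
      φ (coef p k) + φ (coef q k)         ≈⟨ trans (coef-⊕ (map φ p) (map φ q) k) (+-cong (coef-map p k) (coef-map q k)) ⟨
      coef (map φ p ⊕ map φ q) k          ∎
      where
      open ≈-Reasoning

    map-• : ∀ a p → map φ (a • p) ≃ φ a • map φ p
    map-• a p = mk≃ λ k → begin
      coef (map φ (a • p)) k              ≈⟨ trans (coef-map (a • p) k) (⟦⟧-cong (coef-• a p k)) ⟩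
      φ (a * coef p k)                    ≈⟨ *-homo _ _ ⟩
      φ a * φ (coef p k)                  ≈⟨ trans (coef-• (φ a) (map φ p) k) (*-congˡ (coef-map p k)) ⟨
      coef (φ a • map φ p) k              ∎
      where
      open ≈-Reasoning

    map-⊛ : ∀ p q → map φ (p ⊛ q) ≃ map φ p ⊛ map φ q
    map-⊛ []      q = ≃-refl
    map-⊛ (a ∷ p) q = ≃-trans (map-⊕ (a • q) (0# ∷ p ⊛ q)) (⊕-cong (map-• a q) (∷-cong 0#-homo (map-⊛ p q)))

    φ-natR : ∀ k → φ (natR R k) ≈ natR R k
    φ-natR zero    = 0#-homo
    φ-natR (suc k) = trans (+-homo 1# (natR R k)) (+-cong 1#-homo (φ-natR k))

    map-∂ : ∀ p → map φ (∂ p) ≃ ∂ (map φ p)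
    map-∂ p = mk≃ λ j → begin
      coef (map φ (∂ p)) j                        ≈⟨ trans (coef-map (∂ p) j) (⟦⟧-cong (coef-∂ p j)) ⟩
      φ (natR R (suc j) * coef p (suc j))         ≈⟨ *-homo _ _ ⟩
      φ (natR R (suc j)) * φ (coef p (suc j))     ≈⟨ *-cong (φ-natR (suc j)) (sym (coef-map p (suc j))) ⟩
      natR R (suc j) * coef (map φ p) (suc j)     ≈⟨ coef-∂ (map φ p) j ⟨
      coef (∂ (map φ p)) j                        ∎
      where
      open ≈-Reasoning

    map-X- : ∀ a → map φ (X- R a) ≃ X- R (φ a)
    map-X- a = ∷-cong (-‿homo a) (∷-cong 1#-homo ≃-refl)

    map-isAdmissible : IsAdmissible (map φ)
    map-isAdmissible = record
      { cong        = map-cong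
      ; ⊛-homo      = map-⊛
      ; 1-homo      = ∷-cong 1#-homo ≃-refl
      ; degreeBelow = λ {p} (degree< p<n) → degree< λ k n≤k →
          trans (coef-map p k) (trans (⟦⟧-cong (p<n k n≤k)) 0#-homo)
      ; ∂-homo      = λ p → ≃⇒∼ (≃-sym (map-∂ p))
      }

  module _ {σ : Carrier → Carrier} (σ-iso : IsRingIsomorphism σ) where
    open IsRingIsomorphism σ-iso

    σ⁻¹ : Carrier → Carrier
    σ⁻¹ y = proj₁ (surjective y)

    σ-σ⁻¹ : ∀ y → σ (σ⁻¹ y) ≈ y
    σ-σ⁻¹ y = proj₂ (surjective y) refl

    σ⁻¹-σ : ∀ x → σ⁻¹ (σ x) ≈ x
    σ⁻¹-σ x = injective (σ-σ⁻¹ (σ x))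

    σ⁻¹-isRingHomomorphism : IsRingHomomorphism σ⁻¹
    σ⁻¹-isRingHomomorphism = record
      { isSemiringHomomorphism = record
        { isNearSemiringHomomorphism = record
          { +-isMonoidHomomorphism = record
            { isMagmaHomomorphism = record
              { isRelHomomorphism = record
                { cong = λ {x} {y} x≈y → injective (trans (σ-σ⁻¹ x) (trans x≈y (sym (σ-σ⁻¹ y)))) }
              ; homo = λ x y → injective (trans (σ-σ⁻¹ (x + y))
                  (sym (trans (+-homo (σ⁻¹ x) (σ⁻¹ y)) (+-cong (σ-σ⁻¹ x) (σ-σ⁻¹ y)))))
              }
            ; ε-homo = injective (trans (σ-σ⁻¹ 0#) (sym 0#-homo))
            }
          ; *-homo = λ x y → injective (trans (σ-σ⁻¹ (x * y))
              (sym (trans (*-homo (σ⁻¹ x) (σ⁻¹ y)) (*-cong (σ-σ⁻¹ x) (σ-σ⁻¹ y)))))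
          }
        ; 1#-homo = injective (trans (σ-σ⁻¹ 1#) (sym 1#-homo))
        }
      ; -‿homo = λ x → injective (trans (σ-σ⁻¹ (- x)) (sym (trans (-‿homo (σ⁻¹ x)) (-‿cong (σ-σ⁻¹ x)))))
      }

    coefficientMap : PolyAutomorphism
    coefficientMap = record
      { to = map σ ; from = map σ⁻¹
      ; to-admissible = map-isAdmissible isRingHomomorphism
      ; from-admissible = map-isAdmissible σ⁻¹-isRingHomomorphism
      ; from-to = map-inverse {σ} σ⁻¹-σ
      ; to-from = map-inverse {σ⁻¹} σ-σ⁻¹
      }

    realizable-map-⇔ : ∀ {m n Λ M} → Realizable R m n Λ M ⇔ Realizable R m n (λ i → σ (Λ i)) M
    realizable-map-⇔ {Λ = Λ} {M} = realizable-⇔ coefficientMap {M = M}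
      (λ i → ≃⇒∼ (map-X- isRingHomomorphism (Λ i)))
      (λ i → ≃⇒∼ (≃-trans (map-X- σ⁻¹-isRingHomomorphism (σ (Λ i))) (X-cong (σ⁻¹-σ (Λ i)))))

  -- Affine substitution p(x) ↦ p(a x + b)

  -[x+b]+b≈-x : ∀ x b → - (x + b) + b ≈ - x
  -[x+b]+b≈-x x b = begin
    - (x + b) + b     ≈⟨ +-congʳ (-‿+-comm x b) ⟨
    - x + - b + b     ≈⟨ +-assoc (- x) (- b) b ⟩
    - x + (- b + b)   ≈⟨ +-congˡ (-‿inverseˡ b) ⟩
    - x + 0#          ≈⟨ +-identityʳ (- x) ⟩
    - x               ∎
    where
    open ≈-Reasoning

  affine : Carrier → Carrier → Pol
  affine a b = b ∷ a ∷ []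

  substitute : Carrier → Carrier → Pol → Pol
  substitute a b []      = []
  substitute a b (x ∷ p) = const x ⊕ affine a b ⊛ substitute a b p

  module _ (a b : Carrier) where
    private
      S : Pol → Pol
      S = substitute a b

      L : Pol
      L = affine a b

    substitute-[] : ∀ {p} → p ≃ [] → S p ≃ []
    substitute-[] {[]}    p≃[] = ≃-refl
    substitute-[] {x ∷ p} p≃[] = ⊕-cong (const≃[] (∷≃[]-head p≃[]))
      (≃-trans (⊛-congʳ (affine a b) (substitute-[] (∷≃[]-tail p≃[]))) (⊛-zeroʳ (affine a b)))

    substitute-cong : ∀ {p q} → p ≃ q → S p ≃ S q
    substitute-cong {[]}    {[]}    p≃q = ≃-refl
    substitute-cong {[]}    {y ∷ q} p≃q = ≃-sym (substitute-[] (≃-sym p≃q))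
    substitute-cong {x ∷ p} {[]}    p≃q = substitute-[] p≃q
    substitute-cong {x ∷ p} {y ∷ q} p≃q =
      ⊕-cong (∷-cong (∷-injectiveˡ p≃q) ≃-refl) (⊛-congʳ (affine a b) (substitute-cong (∷-injectiveʳ p≃q)))

    substitute-⊕ : ∀ p q → S (p ⊕ q) ≃ S p ⊕ S q
    substitute-⊕ []      q       = ≃-refl
    substitute-⊕ (x ∷ p) []      = ≃-sym (⊕-identityʳ _)
    substitute-⊕ (x ∷ p) (y ∷ q) = begin
      const (x + y) ⊕ L ⊛ S (p ⊕ q)               ≈⟨ ⊕-congˡ (const (x + y)) (⊛-congʳ L (substitute-⊕ p q)) ⟩
      const (x + y) ⊕ L ⊛ (S p ⊕ S q)             ≈⟨ ⊕-congˡ (const (x + y)) (⊛-distribˡ L (S p) (S q)) ⟩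
      (const x ⊕ const y) ⊕ (L ⊛ S p ⊕ L ⊛ S q)   ≈⟨ ⊕-interchange (const x) (const y) (L ⊛ S p) (L ⊛ S q) ⟩
      (const x ⊕ L ⊛ S p) ⊕ (const y ⊕ L ⊛ S q)   ∎
      where
      open ≃-Reasoning

    substitute-• : ∀ u p → S (u • p) ≃ u • S p
    substitute-• u []      = ≃-refl
    substitute-• u (x ∷ p) = begin
      const (u * x) ⊕ L ⊛ S (u • p)     ≈⟨ ⊕-congˡ (const (u * x)) (⊛-congʳ L (substitute-• u p)) ⟩
      const (u * x) ⊕ L ⊛ u • S p       ≈⟨ ⊕-congˡ (const (u * x)) (⊛-• u L (S p)) ⟩
      u • const x ⊕ u • (L ⊛ S p)       ≈⟨ •-distrib-⊕ u (const x) (L ⊛ S p) ⟨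
      u • (const x ⊕ L ⊛ S p)           ∎
      where
      open ≃-Reasoning

    substitute-0∷ : ∀ p → S (0# ∷ p) ≃ affine a b ⊛ S p
    substitute-0∷ p = ⊕-congʳ (affine a b ⊛ S p) (const≃[] refl)

    substitute-⊛ : ∀ p q → S (p ⊛ q) ≃ S p ⊛ S q
    substitute-⊛ []      q = ≃-refl
    substitute-⊛ (x ∷ p) q = begin
      S (x • q ⊕ (0# ∷ p ⊛ q))               ≈⟨ substitute-⊕ (x • q) (0# ∷ p ⊛ q) ⟩
      S (x • q) ⊕ S (0# ∷ p ⊛ q)             ≈⟨ ⊕-cong (substitute-• x q) (substitute-0∷ (p ⊛ q)) ⟩
      x • S q ⊕ L ⊛ S (p ⊛ q)                ≈⟨ ⊕-congˡ (x • S q) (⊛-congʳ L (substitute-⊛ p q)) ⟩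
      x • S q ⊕ L ⊛ (S p ⊛ S q)              ≈⟨ ⊕-cong (const-⊛ x (S q)) (⊛-assoc L (S p) (S q)) ⟨
      const x ⊛ S q ⊕ (L ⊛ S p) ⊛ S q        ≈⟨ ⊛-distribʳ (const x) (L ⊛ S p) (S q) ⟨
      (const x ⊕ L ⊛ S p) ⊛ S q              ∎
      where
      open ≃-Reasoning

    substitute-const : ∀ x → S (const x) ≃ const x
    substitute-const x = ≃-trans (⊕-congˡ (const x) (⊛-zeroʳ (affine a b))) (⊕-identityʳ (const x))

    substitute-X- : ∀ {m μ} → a * μ + b ≈ m → S (X- R m) ≃ a • X- R μ
    substitute-X- {m} {μ} aμ+b≈m = begin
      const (- m) ⊕ affine a b ⊛ S (const 1#)   ≈⟨ ⊕-congˡ (const (- m)) (⊛-congʳ (affine a b) (substitute-const 1#)) ⟩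
      const (- m) ⊕ affine a b ⊛ const 1#       ≈⟨ ⊕-congˡ (const (- m)) (⊛-identityʳ (affine a b)) ⟩
      (- m + b) ∷ a ∷ []                         ≈⟨ ∷-cong -m+b≈a[-μ] (∷-cong (sym (*-identityʳ a)) ≃-refl) ⟩
      a • X- R μ                                 ∎
      where
      open ≃-Reasoning
      -m+b≈a[-μ] : - m + b ≈ a * - μ
      -m+b≈a[-μ] = trans (+-congʳ (-‿cong (sym aμ+b≈m))) (trans (-[x+b]+b≈-x (a * μ) b) (-‿distribʳ-* a μ))

    ∂-substitute : ∀ p → ∂ (S p) ≃ a • S (∂ p)
    ∂-substitute []      = ≃-refl
    ∂-substitute (x ∷ p) = begin
      ∂ (const x ⊕ L ⊛ S p)               ≈⟨ ∂-⊕ (const x) (L ⊛ S p) ⟩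
      ∂ (L ⊛ S p)                         ≈⟨ ∂-leibniz L (S p) ⟩
      ∂ L ⊛ S p ⊕ L ⊛ ∂ (S p)             ≈⟨ ⊕-cong (⊛-congˡ (S p) ∂L≃a) (⊛-congʳ L (∂-substitute p)) ⟩
      const a ⊛ S p ⊕ L ⊛ a • S (∂ p)     ≈⟨ ⊕-cong (const-⊛ a (S p)) (⊛-• a L (S (∂ p))) ⟩
      a • S p ⊕ a • (L ⊛ S (∂ p))         ≈⟨ •-distrib-⊕ a (S p) (L ⊛ S (∂ p)) ⟨
      a • (S p ⊕ L ⊛ S (∂ p))             ≈⟨ •-congˡ a (⊕-congˡ (S p) (substitute-0∷ (∂ p))) ⟨
      a • (S p ⊕ S (0# ∷ ∂ p))            ≈⟨ •-congˡ a (substitute-⊕ p (0# ∷ ∂ p)) ⟨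
      a • S (p ⊕ (0# ∷ ∂ p))              ≈⟨ •-congˡ a (substitute-cong (∂-∷ x p)) ⟨
      a • S (∂ (x ∷ p))                   ∎
      where
      open ≃-Reasoning
      ∂L≃a : ∂ L ≃ const a
      ∂L≃a = ∷-cong (trans (*-congʳ (+-identityʳ 1#)) (*-identityˡ a)) ≃-refl

    affine-⊛-degreeBelow : ∀ {q n} → DegreeBelow q n → DegreeBelow (affine a b ⊛ q) (suc n)
    affine-⊛-degreeBelow {q} q<n = degreeBelow-⊕ (degreeBelow-suc (degreeBelow-• b q<n))
      (degreeBelow-∷ 0# (degreeBelow-resp (≃-sym (const-⊛ a q)) (degreeBelow-• a q<n)))

    substitute-degreeBelow : ∀ {p n} → DegreeBelow p n → DegreeBelow (S p) n
    substitute-degreeBelow {[]}            _      = degreeBelow-[]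
    substitute-degreeBelow {x ∷ p} {zero}  xp<0   =
      degreeBelow-resp (≃-sym (substitute-[] (degreeBelow-zero xp<0))) degreeBelow-[]
    substitute-degreeBelow {x ∷ p} {suc n} xp<1+n =
      degreeBelow-⊕ (degreeBelow-const x) (affine-⊛-degreeBelow (substitute-degreeBelow (degreeBelow-tail xp<1+n)))

  substitute-inverse : ∀ {a a′ b b′} → a * a′ ≈ 1# → b + a * b′ ≈ 0# →
                       ∀ p → substitute a′ b′ (substitute a b p) ≃ p
  substitute-inverse                 aa′≈1 b+ab′≈0 []      = ≃-refl
  substitute-inverse {a} {a′} {b} {b′} aa′≈1 b+ab′≈0 (x ∷ p) = begin
    S′ (const x ⊕ affine a b ⊛ S p)
      ≈⟨ substitute-⊕ a′ b′ (const x) (affine a b ⊛ S p) ⟩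
    S′ (const x) ⊕ S′ (affine a b ⊛ S p)
      ≈⟨ ⊕-cong (substitute-const a′ b′ x) (substitute-⊛ a′ b′ (affine a b) (S p)) ⟩
    const x ⊕ S′ (affine a b) ⊛ S′ (S p)
      ≈⟨ ⊕-congˡ (const x) (⊛-cong S′L≃x (substitute-inverse aa′≈1 b+ab′≈0 p)) ⟩
    const x ⊕ (0# ∷ const 1#) ⊛ p
      ≈⟨ ⊕-congˡ (const x) (x-⊛ p) ⟩
    const x ⊕ (0# ∷ p)
      ≈⟨ ∷-cong (+-identityʳ x) ≃-refl ⟩
    x ∷ p
      ∎
    where
    open ≃-Reasoning
    S S′ : Pol → Pol
    S  = substitute a b
    S′ = substitute a′ b′
    S′L≃x : S′ (affine a b) ≃ 0# ∷ const 1#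
    S′L≃x = begin
      const b ⊕ affine a′ b′ ⊛ S′ (const a)
        ≈⟨ ⊕-congˡ (const b) (⊛-congʳ (affine a′ b′) (substitute-const a′ b′ a)) ⟩
      const b ⊕ affine a′ b′ ⊛ const a            ≈⟨ ⊕-congˡ (const b) (⊛-const a (affine a′ b′)) ⟩
      (b + a * b′) ∷ a * a′ ∷ []                  ≈⟨ ∷-cong b+ab′≈0 (∷-cong aa′≈1 ≃-refl) ⟩
      0# ∷ const 1#                               ∎

  substitute-isAdmissible : ∀ {a a⁻¹} b → a * a⁻¹ ≈ 1# → IsAdmissible (substitute a b)
  substitute-isAdmissible {a} {a⁻¹} b aa⁻¹≈1 = record
    { cong        = substitute-cong a b
    ; ⊛-homo      = substitute-⊛ a b
    ; 1-homo      = substitute-const a b 1#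
    ; degreeBelow = substitute-degreeBelow a b
    ; ∂-homo      = λ p → record
      { factor = a ; factor⁻¹ = a⁻¹ ; factor-inverse = aa⁻¹≈1 ; scaled = ∂-substitute a b p }
    }

  substitute-X-∼ : ∀ {a a⁻¹ b m μ} → a * a⁻¹ ≈ 1# → a * μ + b ≈ m → substitute a b (X- R m) ∼ X- R μ
  substitute-X-∼ {a} {a⁻¹} {b} aa⁻¹≈1 aμ+b≈m = record
    { factor = a ; factor⁻¹ = a⁻¹ ; factor-inverse = aa⁻¹≈1 ; scaled = substitute-X- a b aμ+b≈m }

  module _ {a a⁻¹ : Carrier} (aa⁻¹≈1 : a * a⁻¹ ≈ 1#) (b : Carrier) where
    private
      a⁻¹a≈1 : a⁻¹ * a ≈ 1#
      a⁻¹a≈1 = trans (*-comm a⁻¹ a) aa⁻¹≈1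

      a[a⁻¹x]≈x : ∀ x → a * (a⁻¹ * x) ≈ x
      a[a⁻¹x]≈x x = trans (sym (*-assoc a a⁻¹ x)) (trans (*-congʳ aa⁻¹≈1) (*-identityˡ x))

      b+a[-a⁻¹b]≈0 : b + a * - (a⁻¹ * b) ≈ 0#
      b+a[-a⁻¹b]≈0 = begin
        b + a * - (a⁻¹ * b)   ≈⟨ +-congˡ (-‿distribʳ-* a (a⁻¹ * b)) ⟨
        b + - (a * (a⁻¹ * b)) ≈⟨ +-congˡ (-‿cong (a[a⁻¹x]≈x b)) ⟩
        b + - b               ≈⟨ -‿inverseʳ b ⟩
        0#                    ∎
        where
        open ≈-Reasoning

      a⁻¹[aμ+b]-a⁻¹b≈μ : ∀ μ → a⁻¹ * (a * μ + b) + - (a⁻¹ * b) ≈ μ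
      a⁻¹[aμ+b]-a⁻¹b≈μ μ = begin
        a⁻¹ * (a * μ + b) + - (a⁻¹ * b)             ≈⟨ +-congʳ (distribˡ a⁻¹ (a * μ) b) ⟩
        a⁻¹ * (a * μ) + a⁻¹ * b + - (a⁻¹ * b)       ≈⟨ +-assoc _ _ _ ⟩
        a⁻¹ * (a * μ) + (a⁻¹ * b + - (a⁻¹ * b))     ≈⟨ +-congˡ (-‿inverseʳ (a⁻¹ * b)) ⟩
        a⁻¹ * (a * μ) + 0#                          ≈⟨ +-identityʳ _ ⟩
        a⁻¹ * (a * μ)                               ≈⟨ *-assoc a⁻¹ a μ ⟨
        (a⁻¹ * a) * μ                               ≈⟨ trans (*-congʳ a⁻¹a≈1) (*-identityˡ μ) ⟩
        μ                                           ∎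
        where
        open ≈-Reasoning

    affineSubstitution : PolyAutomorphism
    affineSubstitution = record
      { to              = substitute a b
      ; from            = substitute a⁻¹ (- (a⁻¹ * b))
      ; to-admissible   = substitute-isAdmissible b aa⁻¹≈1
      ; from-admissible = substitute-isAdmissible (- (a⁻¹ * b)) a⁻¹a≈1
      ; from-to         = substitute-inverse aa⁻¹≈1 b+a[-a⁻¹b]≈0
      ; to-from         = substitute-inverse a⁻¹a≈1 (-‿inverseˡ (a⁻¹ * b))
      }

    realizable-affine-⇔ : ∀ {m n Λ M} → Realizable R m n (λ i → a * Λ i + b) M ⇔ Realizable R m n Λ M
    realizable-affine-⇔ {Λ = Λ} {M} = realizable-⇔ affineSubstitution {M = M}
      (λ i → substitute-X-∼ aa⁻¹≈1 refl)
      (λ i → substitute-X-∼ a⁻¹a≈1 (a⁻¹[aμ+b]-a⁻¹b≈μ (Λ i)))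

theorem5 : ∀ {c ℓ} (K : CommutativeRing c ℓ) → IsField K → CharZero K →
    (σ : CommutativeRing.Carrier K → CommutativeRing.Carrier K) → IsAutomorphism K σ →
    (r s : CommutativeRing.Carrier K) → ¬ (CommutativeRing._≈_ K r (CommutativeRing.0# K)) →
    (m n : ℕ) (Λ : Fin m → CommutativeRing.Carrier K) (M : Fin m → Fin (suc n) → ℕ) →
    IsMultiplicityMatrix m n M →
    Realizable K m n Λ M ⇔
    Realizable K m n (λ i → CommutativeRing._+_ K (CommutativeRing._*_ K r (σ (Λ i))) s) M
theorem5 K K-field _ σ σ-automorphism r s r≉0 m n Λ M _ =
  ⇔-sym (realizable-affine-⇔ rr⁻¹≈1 s {Λ = σΛ} {M}) ⇔-∘ realizable-map-⇔ σ-automorphism {Λ = Λ} {M}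
  where
  open CommutativeRing K using (Carrier; _*_; _≈_; 1#)
  open Polynomials K

  rr⁻¹≈1 : r * proj₁ (IsField.inverse K-field r r≉0) ≈ 1#
  rr⁻¹≈1 = proj₂ (IsField.inverse K-field r r≉0)

  σΛ : Fin m → Carrier
  σΛ i = σ (Λ i)
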